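{- Let $(G,k)$ be an instance of CTVD and let $S$ be a (clique, tree)-deletion set of $G$ with $|S| \le 4k$. Let $\mathcal{C}$ be the set of connected components of $G-S$ that are cliques with at least $3$ vertices, and let $H$ be the bipartite graph with parts $S$ and $\mathcal{C}$ in which $s \in S$ is adjacent to $C \in \mathcal{C}$ iff $s$ has a neighbor in $C$ in $G$. Suppose $|\mathcal{C}| \ge 2|S|$, and let $X \subseteq S$ and $\mathcal{Y} \subseteq \mathcal{C}$ be non-empty sets such that there is a $2$-expansion of $X$ into $\mathcal{Y}$ in $H$ and $N_H(\mathcal{Y}) \subseteq X$. Then $(G,k)$ is a yes-instance if and only if $(G - X, k - |X|)$ is a yes-instance.
   Context: CTVD: given a multigraph $G$ (loops and parallel edges allowed) and an integer $k$, decide whether there is $S\subseteq V(G)$ with $|S|\le k$ such that $G-S$ is simple and every connected component of $G-S$ is a clique or a tree; instances with negative $k$ are no-instances. A (clique, tree)-deletion set of $G$ is any $X \subseteq V(G)$ such that $G - X$ is simple and each of its connected components is a clique or a tree. For a bipartite graph with parts $A, B$, a positive integer $q$, $\hat A\subseteq A$ and $\hat B\subseteq B$, a $q$-expansion of $\hat A$ into $\hat B$ is a set $M$ of edges between $\hat A$ and $\hat B$ such that every vertex of $\hat A$ is incident to exactly $q$ edges of $M$ and every vertex of $\hat B$ is incident to at most one edge of $M$ (so exactly $q|\hat A|$ vertices of $\hat B$ are incident to $M$). -}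

module Defs where

open import Data.Nat using (ℕ; _≤_)
open import Data.Integer as ℤ using (ℤ; +_)
open import Data.Fin using (Fin)
import Data.Fin as Fin
open import Data.Fin.Subset using (Subset; _∈_; _⊆_; _─_; ∣_∣; Nonempty)
open import Data.Bool using (Bool)
import Data.Bool as Bool
open import Data.Vec.Properties using (≡-dec)
open import Data.List using (List; []; _∷_; _++_; [_]; length; filter)
open import Data.List.Relation.Unary.All using (All)
open import Data.List.Relation.Unary.Unique.Propositional using (Unique)
import Data.List.Membership.Propositional as L
open import Data.Product using (Σ; ∃; _×_; _,_; proj₁; proj₂)
open import Data.Sum using (_⊎_)
open import Data.Unit using (⊤)
open import Relation.Nullary using (¬_; Dec)
open import Relation.Binary.PropositionalEquality using (_≡_; _≢_)
open import Function.Bundles using (_⇔_)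

-- A finite multigraph.  Its vertex set is the subset V of Fin n;
-- mult u v is the number of edges between u and v (mult v v = number of loops).
-- Values of mult outside V are irrelevant.
record Multigraph (n : ℕ) : Set where
  field
    V        : Subset n
    mult     : Fin n → Fin n → ℕ
    mult-sym : ∀ u v → mult u v ≡ mult v u
open Multigraph public

module _ {n : ℕ} where

  _∖_ : Multigraph n → Subset n → Multigraph n
  G ∖ X = record { V = V G ─ X ; mult = mult G ; mult-sym = mult-sym G }

  -- induced subgraph G[C] (used for C ⊆ V G)
  induced : Multigraph n → Subset n → Multigraph n
  induced G C = record { V = C ; mult = mult G ; mult-sym = mult-sym G }

  Simple : Multigraph n → Set
  Simple G = (∀ u → u ∈ V G → mult G u u ≡ 0)
           × (∀ u v → u ∈ V G → v ∈ V G → mult G u v ≤ 1)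

  Adj : Multigraph n → Fin n → Fin n → Set
  Adj G u v = u ∈ V G × v ∈ V G × u ≢ v × 1 ≤ mult G u v

  data Reach (G : Multigraph n) : Fin n → Fin n → Set where
    here : ∀ {u} → u ∈ V G → Reach G u u
    step : ∀ {u w v} → Adj G u w → Reach G w v → Reach G u v

  Connected : Multigraph n → Subset n → Set
  Connected G C = ∀ u v → u ∈ C → v ∈ C → Reach (induced G C) u v

  IsComponent : Multigraph n → Subset n → Set
  IsComponent G C = Nonempty C × C ⊆ V G × Connected G C
                  × (∀ u v → u ∈ C → Adj G u v → v ∈ C)

  IsClique : Multigraph n → Subset n → Set
  IsClique G C = ∀ u v → u ∈ C → v ∈ C → u ≢ v → Adj G u v

  Walk : Multigraph n → List (Fin n) → Set
  Walk G []            = ⊤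
  Walk G (x ∷ [])      = ⊤
  Walk G (x ∷ y ∷ xs)  = Adj G x y × Walk G (y ∷ xs)

  HasCycle : Multigraph n → Subset n → Set
  HasCycle G C = Σ (Fin n) λ v → Σ (List (Fin n)) λ vs →
      2 ≤ length vs × All (_∈ C) (v ∷ vs) × Unique (v ∷ vs)
      × Walk G (v ∷ vs ++ [ v ])

  IsTree : Multigraph n → Subset n → Set
  IsTree G C = Connected G C × ¬ HasCycle G C

  CTDeletionSet : Multigraph n → Subset n → Set
  CTDeletionSet G X = Simple (G ∖ X)
    × (∀ C → IsComponent (G ∖ X) C → IsClique (G ∖ X) C ⊎ IsTree (G ∖ X) C)

  YesInstance : Multigraph n → ℤ → Set
  YesInstance G k = ∃ λ X → X ⊆ V G × (+ ∣ X ∣) ℤ.≤ k × CTDeletionSet G X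

  BigClique : Multigraph n → Subset n → Subset n → Set
  BigClique G S C = IsComponent (G ∖ S) C × IsClique (G ∖ S) C × 3 ≤ ∣ C ∣

  HAdj : Multigraph n → Subset n → Fin n → Subset n → Set
  HAdj G S s C = s ∈ S × ∃ λ c → c ∈ C × Adj G s c

  _≟S_ : (A B : Subset n) → Dec (A ≡ B)
  _≟S_ = ≡-dec Bool._≟_

  degS : List (Fin n × Subset n) → Fin n → ℕ
  degS M x = length (filter (λ e → proj₁ e Fin.≟ x) M)

  degC : List (Fin n × Subset n) → Subset n → ℕ
  degC M C = length (filter (λ e → proj₂ e ≟S C) M)

  IsExpansion : ℕ → Multigraph n → Subset n → Subset n → List (Subset n)
              → List (Fin n × Subset n) → Set
  IsExpansion q G S X 𝒴 M =
      Unique M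
    × All (λ e → proj₁ e ∈ X × proj₂ e L.∈ 𝒴 × HAdj G S (proj₁ e) (proj₂ e)) M
    × (∀ x → x ∈ X → degS M x ≡ q)
    × (∀ C → C L.∈ 𝒴 → degC M C ≤ 1)

{-# OPTIONS --safe #-}
-- Let U be the union of the cliques in 𝒴.  A solution Y of (G ∖ X, k − ∣X∣) gives the solution X ∪ Y of
-- (G, k).  Conversely let Z solve (G, k) and put Z′ = Z ─ (X ∪ U).  Since N(𝒴) ⊆ X, every C ∈ 𝒴 is closed
-- in G ∖ X ∖ Z′, so a component meeting C lies inside the clique C, and every other component lies inside
-- a component of G ∖ Z; hence Z′ solves G ∖ X.  For the size it suffices that ∣X∣ ≤ ∣Z ∩ (X ∪ U)∣.  A vertex
-- a ∈ X outside Z has two expansion partners C₁ ≠ C₂, and Z meets one of them: otherwise the component of a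
-- in G ∖ Z contains the triangles of C₁ (so it is no tree) and vertices of two different components of
-- G ∖ S (so it is no clique).  Sending a to itself or to such a vertex of Z is injective, because the
-- expansion matches each C ∈ 𝒴 with at most one vertex of X.
module Submission where

open import Defs
open import Data.Nat as ℕ using (ℕ; zero; suc; _≤_; _<_; _*_; z≤n; s≤s; _≤?_)
open import Data.Nat.Properties as ℕ using (≤-refl; ≤-trans; ≤-reflexive; ≤-antisym; <⇒≤; ≰⇒>)
open import Data.Integer as ℤ using (ℤ; +_; _-_; +≤+)
import Data.Integer.Properties as ℤ
open import Algebra.Properties.AbelianGroup ℤ.+-0-abelianGroup using (//-rightDividesˡ; //-rightDividesʳ)
open import Data.Bool using (true; false)
open import Data.Vec using ([]; _∷_; here; there)
open import Data.Fin using (Fin; zero)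
import Data.Fin.Properties as Fin
open import Data.Fin.Subset using (Subset; _∈_; _∉_; _⊆_; _⊂_; _∩_; _∪_; _─_; ⋃; ⁅_⁆; ⊤; ∣_∣; Nonempty; Empty)
open import Data.Fin.Subset.Properties
open import Data.List using (List; []; _∷_; length; filter)
import Data.List.Membership.Propositional as L
open import Data.List.Membership.Propositional.Properties using (∈-filter⁺; ∈-filter⁻)
open import Data.List.Relation.Unary.Any using (here; there)
open import Data.List.Relation.Unary.All as All using (All; []; _∷_)
import Data.List.Relation.Unary.All.Properties as All
open import Data.List.Relation.Unary.AllPairs using ([]; _∷_)
open import Data.List.Relation.Unary.Unique.Propositional using (Unique)
import Data.List.Relation.Unary.Unique.Propositional.Properties as Unique
open import Data.Product using (Σ; ∃; ∃₂; _×_; _,_; proj₁; proj₂)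
open import Data.Sum using (_⊎_; inj₁; inj₂)
open import Data.Unit using (tt)
open import Data.Empty using (⊥-elim)
open import Function using (_∘_; id)
open import Function.Bundles using (_⇔_; mk⇔)
open import Relation.Nullary using (¬_; Dec; yes; no; contradiction)
open import Relation.Nullary.Decidable using (_×-dec_; ¬?)
open import Relation.Unary using (Pred; Decidable)
open import Relation.Binary.PropositionalEquality using (_≡_; _≢_; refl; sym; trans; cong; subst)

private variable
  n : ℕ
  x y : Fin n
  p q : Subset n

x∈p─q⇒x∉q : ∀ (p q : Subset n) → x ∈ p ─ q → x ∉ q
x∈p─q⇒x∉q (true  ∷ p) (false ∷ q) here       = λ ()
x∈p─q⇒x∉q (_     ∷ p) (_     ∷ q) (there x∈) = x∈p─q⇒x∉q p q x∈ ∘ drop-there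
x∈p─q⇒x∉q {x = zero} (_     ∷ p) (true  ∷ q) ()
x∈p─q⇒x∉q {x = zero} (false ∷ p) (false ∷ q) ()

x∈p─q⁻ : ∀ (p q : Subset n) → x ∈ p ─ q → x ∈ p × x ∉ q
x∈p─q⁻ p q x∈ = p─q⊆p p q x∈ , x∈p─q⇒x∉q p q x∈

x∈p-y⁻ : x ∈ p ─ ⁅ y ⁆ → x ∈ p × x ≢ y
x∈p-y⁻ {p = p} {y = y} x∈ with x∈p─q⁻ p ⁅ y ⁆ x∈
... | x∈p , x∉⁅y⁆ = x∈p , x∉⁅y⁆⇒x≢y x∉⁅y⁆

x∈⋃⁻ : ∀ (ps : List (Subset n)) → x ∈ ⋃ ps → ∃ λ p → p L.∈ ps × x ∈ p
x∈⋃⁻ []       x∈ = contradiction x∈ ∉⊥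
x∈⋃⁻ (p ∷ ps) x∈ with x∈p∪q⁻ p (⋃ ps) x∈
... | inj₁ x∈p  = p , here refl , x∈p
... | inj₂ x∈⋃ with x∈⋃⁻ ps x∈⋃
...   | q , q∈ps , x∈q = q , there q∈ps , x∈q

x∈⋃⁺ : ∀ {ps : List (Subset n)} → p L.∈ ps → x ∈ p → x ∈ ⋃ ps
x∈⋃⁺ (here refl)  x∈p = x∈p∪q⁺ (inj₁ x∈p)
x∈⋃⁺ (there p∈ps) x∈p = x∈p∪q⁺ (inj₂ (x∈⋃⁺ p∈ps x∈p))

∣p─q∣+∣p∩q∣≡∣p∣ : ∀ (p q : Subset n) → ∣ p ─ q ∣ ℕ.+ ∣ p ∩ q ∣ ≡ ∣ p ∣
∣p─q∣+∣p∩q∣≡∣p∣ []          []          = refl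
∣p─q∣+∣p∩q∣≡∣p∣ (true  ∷ p) (true  ∷ q) = trans (ℕ.+-suc _ _) (cong suc (∣p─q∣+∣p∩q∣≡∣p∣ p q))
∣p─q∣+∣p∩q∣≡∣p∣ (true  ∷ p) (false ∷ q) = cong suc (∣p─q∣+∣p∩q∣≡∣p∣ p q)
∣p─q∣+∣p∩q∣≡∣p∣ (false ∷ p) (true  ∷ q) = ∣p─q∣+∣p∩q∣≡∣p∣ p q
∣p─q∣+∣p∩q∣≡∣p∣ (false ∷ p) (false ∷ q) = ∣p─q∣+∣p∩q∣≡∣p∣ p q

∣p∪q∣≤∣p∣+∣q∣ : ∀ (p q : Subset n) → ∣ p ∪ q ∣ ≤ ∣ p ∣ ℕ.+ ∣ q ∣
∣p∪q∣≤∣p∣+∣q∣ p q = begin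
  ∣ p ∪ q ∣                           ≡⟨ ∣p─q∣+∣p∩q∣≡∣p∣ (p ∪ q) q ⟨
  ∣ (p ∪ q) ─ q ∣ ℕ.+ ∣ (p ∪ q) ∩ q ∣ ≤⟨ ℕ.+-mono-≤ (p⊆q⇒∣p∣≤∣q∣ p∪q─q⊆p) (∣p∩q∣≤∣q∣ (p ∪ q) q) ⟩
  ∣ p ∣ ℕ.+ ∣ q ∣                     ∎
  where
  open ℕ.≤-Reasoning
  p∪q─q⊆p : (p ∪ q) ─ q ⊆ p
  p∪q─q⊆p x∈ with x∈p─q⁻ (p ∪ q) q x∈
  ... | x∈p∪q , x∉q with x∈p∪q⁻ p q x∈p∪q
  ...   | inj₁ x∈p = x∈p
  ...   | inj₂ x∈q = contradiction x∈q x∉q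

∣p∣≤1+∣p-x∣ : ∀ (p : Subset n) x → ∣ p ∣ ≤ suc ∣ p ─ ⁅ x ⁆ ∣
∣p∣≤1+∣p-x∣ p x = begin
  ∣ p ∣                           ≤⟨ p⊆q⇒∣p∣≤∣q∣ p⊆⁅x⁆∪[p-x] ⟩
  ∣ ⁅ x ⁆ ∪ (p ─ ⁅ x ⁆) ∣         ≤⟨ ∣p∪q∣≤∣p∣+∣q∣ ⁅ x ⁆ (p ─ ⁅ x ⁆) ⟩
  ∣ ⁅ x ⁆ ∣ ℕ.+ ∣ p ─ ⁅ x ⁆ ∣     ≡⟨ cong (ℕ._+ ∣ p ─ ⁅ x ⁆ ∣) (∣⁅x⁆∣≡1 x) ⟩
  suc ∣ p ─ ⁅ x ⁆ ∣               ∎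
  where
  open ℕ.≤-Reasoning
  p⊆⁅x⁆∪[p-x] : p ⊆ ⁅ x ⁆ ∪ (p ─ ⁅ x ⁆)
  p⊆⁅x⁆∪[p-x] {y} y∈p with y Fin.≟ x
  ... | yes refl = x∈p∪q⁺ (inj₁ (x∈⁅x⁆ x))
  ... | no y≢x   = x∈p∪q⁺ (inj₂ (x∈p∧x≢y⇒x∈p-y y∈p y≢x))

1+k≤∣p∣⇒k≤∣p-x∣ : ∀ {k} (p : Subset n) x → suc k ≤ ∣ p ∣ → k ≤ ∣ p ─ ⁅ x ⁆ ∣
1+k≤∣p∣⇒k≤∣p-x∣ p x 1+k≤∣p∣ = ℕ.≤-pred (≤-trans 1+k≤∣p∣ (∣p∣≤1+∣p-x∣ p x))

Empty⇒∣p∣≡0 : ∀ {n} {p : Subset n} → Empty p → ∣ p ∣ ≡ 0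
Empty⇒∣p∣≡0 {n} empty = trans (cong ∣_∣ (Empty-unique empty)) (∣⊥∣≡0 n)

0<∣p∣⇒Nonempty : ∀ (p : Subset n) → 0 < ∣ p ∣ → Nonempty p
0<∣p∣⇒Nonempty p 0<∣p∣ with nonempty? p
... | yes nonempty = nonempty
... | no empty     = contradiction (Empty⇒∣p∣≡0 empty) (ℕ.>⇒≢ 0<∣p∣)

3≤∣p∣⇒distinct-triple : ∀ (p : Subset n) → 3 ≤ ∣ p ∣ →
  ∃ λ u → ∃₂ λ v w → u ∈ p × v ∈ p × w ∈ p × u ≢ v × v ≢ w × w ≢ u
3≤∣p∣⇒distinct-triple p 3≤∣p∣
  with 0<∣p∣⇒Nonempty p (≤-trans (s≤s z≤n) 3≤∣p∣)
... | u , u∈p with 0<∣p∣⇒Nonempty (p ─ ⁅ u ⁆) (≤-trans (s≤s z≤n) (1+k≤∣p∣⇒k≤∣p-x∣ p u 3≤∣p∣))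
... | v , v∈p-u
  with 0<∣p∣⇒Nonempty (p ─ ⁅ u ⁆ ─ ⁅ v ⁆) (1+k≤∣p∣⇒k≤∣p-x∣ (p ─ ⁅ u ⁆) v (1+k≤∣p∣⇒k≤∣p-x∣ p u 3≤∣p∣))
... | w , w∈p-u-v with x∈p-y⁻ v∈p-u | x∈p-y⁻ w∈p-u-v
... | v∈p , v≢u | w∈p-u , w≢v with x∈p-y⁻ w∈p-u
... | w∈p , w≢u = u , v , w , u∈p , v∈p , w∈p , v≢u ∘ sym , w≢v ∘ sym , w≢u

module _ (R : Fin n → Fin n → Set) where

  injective-relation⇒∣p∣≤∣q∣ : (∀ {a} → a ∈ p → ∃ λ b → b ∈ q × R a b) →
    (∀ {a a′ b} → a ∈ p → a′ ∈ p → R a b → R a′ b → a ≡ a′) → ∣ p ∣ ≤ ∣ q ∣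
  injective-relation⇒∣p∣≤∣q∣ = go _ ≤-refl
    where
    go : ∀ k {p q} → ∣ p ∣ ≤ k → (∀ {a} → a ∈ p → ∃ λ b → b ∈ q × R a b) →
      (∀ {a a′ b} → a ∈ p → a′ ∈ p → R a b → R a′ b → a ≡ a′) → ∣ p ∣ ≤ ∣ q ∣
    go zero    ∣p∣≤0 _ _ = ≤-trans ∣p∣≤0 z≤n
    go (suc k) {p} {q} ∣p∣≤1+k total injective with nonempty? p
    ... | no empty = subst (_≤ ∣ q ∣) (sym (Empty⇒∣p∣≡0 empty)) z≤n
    ... | yes (a , a∈p) with total a∈p
    ... | b , b∈q , Rab = begin
      ∣ p ∣              ≤⟨ ∣p∣≤1+∣p-x∣ p a ⟩
      suc ∣ p ─ ⁅ a ⁆ ∣  ≤⟨ s≤s (go k ∣p-a∣≤k total′ injective′) ⟩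
      suc ∣ q ─ ⁅ b ⁆ ∣  ≤⟨ x∈p⇒∣p-x∣<∣p∣ b∈q ⟩
      ∣ q ∣              ∎
      where
      open ℕ.≤-Reasoning
      ∣p-a∣≤k : ∣ p ─ ⁅ a ⁆ ∣ ≤ k
      ∣p-a∣≤k = ℕ.≤-pred (≤-trans (x∈p⇒∣p-x∣<∣p∣ a∈p) ∣p∣≤1+k)
      total′ : ∀ {a′} → a′ ∈ p ─ ⁅ a ⁆ → ∃ λ b′ → b′ ∈ q ─ ⁅ b ⁆ × R a′ b′
      total′ a′∈ with x∈p-y⁻ a′∈
      ... | a′∈p , a′≢a with total a′∈p
      ... | b′ , b′∈q , Ra′b′ = b′ , x∈p∧x≢y⇒x∈p-y b′∈q b′≢b , Ra′b′
        where
        b′≢b : b′ ≢ b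
        b′≢b refl = a′≢a (injective a′∈p a∈p Ra′b′ Rab)
      injective′ : ∀ {a₁ a₂ c} → a₁ ∈ p ─ ⁅ a ⁆ → a₂ ∈ p ─ ⁅ a ⁆ → R a₁ c → R a₂ c → a₁ ≡ a₂
      injective′ a₁∈ a₂∈ = injective (p─q⊆p p _ a₁∈) (p─q⊆p p _ a₂∈)

module _ {a} {A : Set a} where

  private variable
    xs ys : List A
    x′ y′ : A

  ∈-length≤1⇒≡ : length xs ≤ 1 → x′ L.∈ xs → y′ L.∈ xs → x′ ≡ y′
  ∈-length≤1⇒≡ {xs = _ ∷ []}    _        (here refl) (here refl) = refl
  ∈-length≤1⇒≡ {xs = _ ∷ _ ∷ _} (s≤s ()) _           _

  2≤length⇒distinct : Unique ys → 2 ≤ length ys → ∃₂ λ x y → x L.∈ ys × y L.∈ ys × x ≢ y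
  2≤length⇒distinct {ys = x ∷ y ∷ _} ((x≢y ∷ _) ∷ _) _ = x , y , here refl , there (here refl) , x≢y
  2≤length⇒distinct {ys = _ ∷ []}    _ (s≤s ())

  module _ {ℓ} {P : Pred A ℓ} (P? : Decidable P) where

    filter-length≤1⇒≡ : length (filter P? xs) ≤ 1 → x′ L.∈ xs → y′ L.∈ xs → P x′ → P y′ → x′ ≡ y′
    filter-length≤1⇒≡ ≤1 x∈ y∈ px py = ∈-length≤1⇒≡ ≤1 (∈-filter⁺ P? x∈ px) (∈-filter⁺ P? y∈ py)

    2≤filter-length⇒distinct : Unique xs → 2 ≤ length (filter P? xs) →
      ∃₂ λ x y → x L.∈ xs × y L.∈ xs × P x × P y × x ≢ y
    2≤filter-length⇒distinct xs-unique 2≤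
      with 2≤length⇒distinct (Unique.filter⁺ P? xs-unique) 2≤
    ... | x , y , x∈ , y∈ , x≢y with ∈-filter⁻ P? x∈ | ∈-filter⁻ P? y∈
    ... | x∈xs , px | y∈xs , py = x , y , x∈xs , y∈xs , px , py , x≢y

module _ {m n : ℕ} {k : ℤ} where

  m+n≤k⇒m≤k-n : + (m ℕ.+ n) ℤ.≤ k → + m ℤ.≤ k - + n
  m+n≤k⇒m≤k-n m+n≤k = begin
    + m                  ≡⟨ //-rightDividesʳ (+ n) (+ m) ⟨
    + m ℤ.+ + n - + n    ≤⟨ ℤ.+-monoˡ-≤ (ℤ.- + n) (subst (ℤ._≤ k) (ℤ.pos-+ m n) m+n≤k) ⟩
    k - + n              ∎
    where open ℤ.≤-Reasoning

  m≤k-n⇒m+n≤k : + m ℤ.≤ k - + n → + (m ℕ.+ n) ℤ.≤ k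
  m≤k-n⇒m+n≤k m≤k-n = begin
    + (m ℕ.+ n)          ≡⟨ ℤ.pos-+ m n ⟩
    + m ℤ.+ + n          ≤⟨ ℤ.+-monoˡ-≤ (+ n) m≤k-n ⟩
    k - + n ℤ.+ + n      ≡⟨ //-rightDividesˡ (+ n) k ⟩
    k                    ∎
    where open ℤ.≤-Reasoning

private variable
  H : Multigraph n
  u v w : Fin n
  A B C D R : Subset n

CliqueTreeGraph : Multigraph n → Set
CliqueTreeGraph H = Simple H × (∀ C → IsComponent H C → IsClique H C ⊎ IsTree H C)

Closed : Multigraph n → Subset n → Set
Closed H R = ∀ u v → u ∈ R → Adj H u v → v ∈ R

adj-sym : Adj H u v → Adj H v u
adj-sym {H = H} {u} {v} (u∈V , v∈V , u≢v , u~v) = v∈V , u∈V , u≢v ∘ sym , subst (1 ≤_) (mult-sym H u v) u~v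

adj? : (H : Multigraph n) → ∀ u v → Dec (Adj H u v)
adj? H u v = (u ∈? V H) ×-dec (v ∈? V H) ×-dec ¬? (u Fin.≟ v) ×-dec (1 ≤? mult H u v)

reach-end : Reach H u v → v ∈ V H
reach-end (here v∈V)     = v∈V
reach-end (step _ reach) = reach-end reach

reach-snoc : Reach H u v → Adj H v w → Reach H u w
reach-snoc (here _)          v~w = step v~w (here (proj₁ (proj₂ v~w)))
reach-snoc (step u~x reach)  v~w = step u~x (reach-snoc reach v~w)

reach-sym : Reach H u v → Reach H v u
reach-sym (here u∈V)       = here u∈V
reach-sym {H = H} (step u~x reach) = reach-snoc (reach-sym reach) (adj-sym {H = H} u~x)

reach-trans : Reach H u v → Reach H v w → Reach H u w
reach-trans (here _)         reach′ = reach′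
reach-trans (step u~x reach) reach′ = step u~x (reach-trans reach reach′)

reach-closed : Closed H R → u ∈ R → Reach H u v → v ∈ R
reach-closed closed u∈R (here _)         = u∈R
reach-closed closed u∈R (step u~x reach) = reach-closed closed (closed _ _ u∈R u~x) reach

reach-restrict : Closed H R → u ∈ R → Reach H u v → Reach (induced H R) u v
reach-restrict closed u∈R (here _) = here u∈R
reach-restrict {R = R} closed u∈R (step {w = x} u~x@(_ , _ , u≢x , m) reach) =
  step (u∈R , x∈R , u≢x , m) (reach-restrict closed x∈R reach)
  where
  x∈R : x ∈ R
  x∈R = closed _ _ u∈R u~x

reach-lift : C ⊆ V H → Reach (induced H C) u v → Reach H u v
reach-lift C⊆V (here u∈C)                           = here (C⊆V u∈C)
reach-lift C⊆V (step (u∈C , x∈C , u≢x , m) reach) = step (C⊆V u∈C , C⊆V x∈C , u≢x , m) (reach-lift C⊆V reach)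

-- Adds one outside neighbour of R at a time; once the fuel f is spent, n ≤ ∣ R ∣ forces R = ⊤.
private
  grow : (H : Multigraph n) (f : ℕ) → n ≤ f ℕ.+ ∣ R ∣ → u ∈ R → (∀ {v} → v ∈ R → Reach H u v) →
         ∃ λ D → u ∈ D × (∀ {v} → v ∈ D → Reach H u v) × Closed H D
  grow {n = n} {R = R} H zero n≤∣R∣ u∈R reach = R , u∈R , reach , λ _ v _ _ → subst (v ∈_) (sym R≡⊤) ∈⊤
    where
    R≡⊤ : R ≡ ⊤
    R≡⊤ = ∣p∣≡n⇒p≡⊤ (≤-antisym (∣p∣≤n R) n≤∣R∣)
  grow {n = n} {R = R} {u = u} H (suc f) n≤1+f+∣R∣ u∈R reach
    with Fin.any? (λ x → Fin.any? (λ y → (x ∈? R) ×-dec adj? H x y ×-dec ¬? (y ∈? R)))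
  ... | yes (x , y , x∈R , x~y , y∉R) = grow H f n≤f+∣R∪⁅y⁆∣ (x∈p∪q⁺ (inj₁ u∈R)) reach′
    where
    R⊂R∪⁅y⁆ : R ⊂ R ∪ ⁅ y ⁆
    R⊂R∪⁅y⁆ = p⊆p∪q ⁅ y ⁆ , y , q⊆p∪q R ⁅ y ⁆ (x∈⁅x⁆ y) , y∉R
    n≤f+∣R∪⁅y⁆∣ : n ≤ f ℕ.+ ∣ R ∪ ⁅ y ⁆ ∣
    n≤f+∣R∪⁅y⁆∣ = begin
      n                    ≤⟨ n≤1+f+∣R∣ ⟩
      suc f ℕ.+ ∣ R ∣      ≡⟨ ℕ.+-suc f ∣ R ∣ ⟨
      f ℕ.+ suc ∣ R ∣      ≤⟨ ℕ.+-monoʳ-≤ f (p⊂q⇒∣p∣<∣q∣ R⊂R∪⁅y⁆) ⟩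
      f ℕ.+ ∣ R ∪ ⁅ y ⁆ ∣  ∎
      where open ℕ.≤-Reasoning
    reach′ : ∀ {v} → v ∈ R ∪ ⁅ y ⁆ → Reach H u v
    reach′ v∈ with x∈p∪q⁻ R ⁅ y ⁆ v∈
    ... | inj₁ v∈R   = reach v∈R
    ... | inj₂ v∈⁅y⁆ = subst (Reach H u) (sym (x∈⁅y⁆⇒x≡y y v∈⁅y⁆)) (reach-snoc (reach x∈R) x~y)
  ... | no nothing-leaves = R , u∈R , reach , closed
    where
    closed : Closed H R
    closed x y x∈R x~y with y ∈? R
    ... | yes y∈R = y∈R
    ... | no y∉R  = contradiction (x , y , x∈R , x~y , y∉R) nothing-leaves

component-exists : u ∈ V H → ∃ λ D → IsComponent H D × u ∈ D
component-exists {n} {u} {H} u∈V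
  with grow H n (ℕ.m≤m+n n _) (x∈⁅x⁆ u) (λ v∈⁅u⁆ → subst (Reach H u) (sym (x∈⁅y⁆⇒x≡y u v∈⁅u⁆)) (here u∈V))
... | D , u∈D , reach , closed = D , ((u , u∈D) , (λ v∈D → reach-end (reach v∈D)) , connected , closed) , u∈D
  where
  connected : Connected H D
  connected v w v∈D w∈D = reach-restrict closed v∈D (reach-trans (reach-sym (reach v∈D)) (reach w∈D))

connected-⊆-closed : C ⊆ V H → Connected H C → Closed H R → u ∈ C → u ∈ R → C ⊆ R
connected-⊆-closed C⊆V connected closed u∈C u∈R v∈C =
  reach-closed closed u∈R (reach-lift C⊆V (connected _ _ u∈C v∈C))

components-≡ : IsComponent H C → IsComponent H D → u ∈ C → u ∈ D → C ≡ D
components-≡ (_ , C⊆V , C-connected , C-closed) (_ , D⊆V , D-connected , D-closed) u∈C u∈D =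
  ⊆-antisym (connected-⊆-closed C⊆V C-connected D-closed u∈C u∈D)
            (connected-⊆-closed D⊆V D-connected C-closed u∈D u∈C)

clique⇒HasCycle : IsClique H C → 3 ≤ ∣ C ∣ → HasCycle H C
clique⇒HasCycle {C = C} clique 3≤∣C∣ =
  let (u , v , w , u∈ , v∈ , w∈ , u≢v , v≢w , w≢u) = 3≤∣p∣⇒distinct-triple C 3≤∣C∣ in
  u , v ∷ w ∷ [] , s≤s (s≤s z≤n) , u∈ ∷ v∈ ∷ w∈ ∷ [] ,
  (u≢v ∷ w≢u ∘ sym ∷ []) ∷ (v≢w ∷ []) ∷ [] ∷ [] ,
  clique u v u∈ v∈ u≢v , clique v w v∈ w∈ v≢w , clique w u w∈ u∈ w≢u , tt

module _ (G : Multigraph n) where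

  adj-transfer : Adj (induced G A) u v → u ∈ B → v ∈ B → Adj (induced G B) u v
  adj-transfer (_ , _ , u≢v , u~v) u∈B v∈B = u∈B , v∈B , u≢v , u~v

  clique-transfer : IsClique (induced G A) D → C ⊆ D → C ⊆ B → IsClique (induced G B) C
  clique-transfer D-clique C⊆D C⊆B u v u∈C v∈C u≢v =
    adj-transfer (D-clique u v (C⊆D u∈C) (C⊆D v∈C) u≢v) (C⊆B u∈C) (C⊆B v∈C)

  walk-transfer : ∀ {vs} → All (_∈ A) vs → Walk (induced G B) vs → Walk (induced G A) vs
  walk-transfer []                   _             = tt
  walk-transfer (_ ∷ [])             _             = tt
  walk-transfer (u∈A ∷ v∈A ∷ vs⊆A) (u~v , walk) = adj-transfer u~v u∈A v∈A , walk-transfer (v∈A ∷ vs⊆A) walk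

  cycle-transfer : C ⊆ D → D ⊆ A → HasCycle (induced G B) C → HasCycle (induced G A) D
  cycle-transfer C⊆D D⊆A (v , vs , 2≤∣vs∣ , v∷vs⊆C@(v∈C ∷ vs⊆C) , unique , closed-walk) =
    v , vs , 2≤∣vs∣ , All.map C⊆D v∷vs⊆C , unique ,
    walk-transfer (All.map (D⊆A ∘ C⊆D) (v∈C ∷ All.++⁺ vs⊆C (v∈C ∷ []))) closed-walk

  clique-or-tree-transfer : D ⊆ A → C ⊆ D → C ⊆ B → Connected (induced G B) C →
    IsClique (induced G A) D ⊎ IsTree (induced G A) D → IsClique (induced G B) C ⊎ IsTree (induced G B) C
  clique-or-tree-transfer _   C⊆D C⊆B _           (inj₁ D-clique)         =
    inj₁ (clique-transfer D-clique C⊆D C⊆B)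
  clique-or-tree-transfer D⊆A C⊆D _   C-connected (inj₂ (_ , D-acyclic)) =
    inj₂ (C-connected , D-acyclic ∘ cycle-transfer C⊆D D⊆A)

  deletion-set-∪ : ∀ {X Y} → CTDeletionSet (G ∖ X) Y → CTDeletionSet G (X ∪ Y)
  deletion-set-∪ {X} {Y} = subst (CliqueTreeGraph ∘ induced G) (p─q─r≡p─q∪r (V G) X Y)

  lift-yes-instance : ∀ {X k} → X ⊆ V G → YesInstance (G ∖ X) (k - + ∣ X ∣) → YesInstance G k
  lift-yes-instance {X} X⊆V (Y , Y⊆V∖X , ∣Y∣≤k-∣X∣ , Y-deletion) =
    X ∪ Y , X∪Y⊆V , ℤ.≤-trans (+≤+ ∣X∪Y∣≤∣Y∣+∣X∣) (m≤k-n⇒m+n≤k ∣Y∣≤k-∣X∣) , deletion-set-∪ Y-deletion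
    where
    X∪Y⊆V : X ∪ Y ⊆ V G
    X∪Y⊆V u∈X∪Y with x∈p∪q⁻ X Y u∈X∪Y
    ... | inj₁ u∈X = X⊆V u∈X
    ... | inj₂ u∈Y = p─q⊆p (V G) X (Y⊆V∖X u∈Y)
    ∣X∪Y∣≤∣Y∣+∣X∣ : ∣ X ∪ Y ∣ ≤ ∣ Y ∣ ℕ.+ ∣ X ∣
    ∣X∪Y∣≤∣Y∣+∣X∣ = ≤-trans (∣p∪q∣≤∣p∣+∣q∣ X Y) (≤-reflexive (ℕ.+-comm ∣ X ∣ ∣ Y ∣))

  surviving-big-clique-neighbour-unique : ∀ {S Z C₁ C₂ a} → CTDeletionSet G Z → a ∈ V (G ∖ Z) →
    BigClique G S C₁ → BigClique G S C₂ → HAdj G S a C₁ → HAdj G S a C₂ →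
    C₁ ⊆ V (G ∖ Z) → C₂ ⊆ V (G ∖ Z) → C₁ ≡ C₂
  surviving-big-clique-neighbour-unique {S} {Z} {C₁} {C₂} {a} (_ , components) a∈V∖Z
    (C₁-component@(_ , C₁⊆V∖S , C₁-connected , C₁-closed) , C₁-clique , 3≤∣C₁∣)
    (C₂-component@(_ , C₂⊆V∖S , _) , _)
    (_ , c₁ , c₁∈C₁ , a~c₁) (_ , c₂ , c₂∈C₂ , a~c₂) C₁⊆V∖Z C₂⊆V∖Z
    with component-exists a∈V∖Z
  ... | D , D-component@(_ , D⊆V∖Z , _ , D-closed) , a∈D = D-clique-or-tree (components D D-component)
    where
    c₁∈D : c₁ ∈ D
    c₁∈D = D-closed a c₁ a∈D (adj-transfer a~c₁ a∈V∖Z (C₁⊆V∖Z c₁∈C₁))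
    c₂∈D : c₂ ∈ D
    c₂∈D = D-closed a c₂ a∈D (adj-transfer a~c₂ a∈V∖Z (C₂⊆V∖Z c₂∈C₂))
    D-clique-or-tree : IsClique (G ∖ Z) D ⊎ IsTree (G ∖ Z) D → C₁ ≡ C₂
    D-clique-or-tree (inj₁ D-clique) = components-≡ C₁-component C₂-component c₂∈C₁ c₂∈C₂
      where
      c₂∈C₁ : c₂ ∈ C₁
      c₂∈C₁ with c₁ Fin.≟ c₂
      ... | yes refl = c₁∈C₁
      ... | no c₁≢c₂ = C₁-closed c₁ c₂ c₁∈C₁ c₁~c₂
        where
        c₁~c₂ : Adj (G ∖ S) c₁ c₂
        c₁~c₂ = adj-transfer (D-clique c₁ c₂ c₁∈D c₂∈D c₁≢c₂) (C₁⊆V∖S c₁∈C₁) (C₂⊆V∖S c₂∈C₂)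
    D-clique-or-tree (inj₂ (_ , D-acyclic)) = ⊥-elim (D-acyclic
      (cycle-transfer C₁⊆D D⊆V∖Z (clique⇒HasCycle (clique-transfer C₁-clique id C₁⊆V∖Z) 3≤∣C₁∣)))
      where
      C₁⊆D : C₁ ⊆ D
      C₁⊆D = connected-⊆-closed {H = G ∖ Z} C₁⊆V∖Z C₁-connected D-closed c₁∈C₁ c₁∈D

module Reduction (G : Multigraph n) (S X : Subset n) (𝒴 : List (Subset n))
  (S⊆V : S ⊆ V G) (S-deletion : CTDeletionSet G S) (X⊆S : X ⊆ S) (𝒴-big : All (BigClique G S) 𝒴)
  (N[𝒴]⊆X : ∀ s C → C L.∈ 𝒴 → HAdj G S s C → s ∈ X) where

  U : Subset n
  U = ⋃ 𝒴

  𝒴-component : C L.∈ 𝒴 → IsComponent (G ∖ S) C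
  𝒴-component C∈𝒴 = proj₁ (All.lookup 𝒴-big C∈𝒴)

  𝒴⊆V∖S : C L.∈ 𝒴 → C ⊆ V (G ∖ S)
  𝒴⊆V∖S C∈𝒴 = proj₁ (proj₂ (𝒴-component C∈𝒴))

  X∩𝒴-empty : C L.∈ 𝒴 → u ∈ X → u ∉ C
  X∩𝒴-empty C∈𝒴 u∈X u∈C = proj₂ (x∈p─q⁻ (V G) S (𝒴⊆V∖S C∈𝒴 u∈C)) (X⊆S u∈X)

  𝒴-closed : C L.∈ 𝒴 → B ⊆ V G ─ X → Closed (induced G B) C
  𝒴-closed {C} C∈𝒴 B⊆V∖X u v u∈C u~v@(_ , v∈B , _) with x∈p─q⁻ (V G) X (B⊆V∖X v∈B) | v ∈? S
  ... | v∈V , v∉X | yes v∈S =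
    contradiction (N[𝒴]⊆X v C C∈𝒴 (v∈S , u , u∈C , adj-sym {H = G} (adj-transfer G u~v u∈V v∈V))) v∉X
    where
    u∈V : u ∈ V G
    u∈V = p─q⊆p (V G) S (𝒴⊆V∖S C∈𝒴 u∈C)
  ... | v∈V , _   | no v∉S =
    proj₂ (proj₂ (proj₂ (𝒴-component C∈𝒴))) u v u∈C
      (adj-transfer G u~v (𝒴⊆V∖S C∈𝒴 u∈C) (x∈p∧x∉q⇒x∈p─q v∈V v∉S))

  module _ {Z : Subset n} (Z-deletion : CTDeletionSet G Z) where

    private
      G′ : Multigraph n
      G′ = (G ∖ X) ∖ (Z ─ (X ∪ U))

    V′⊆V∖X : V G′ ⊆ V G ─ X
    V′⊆V∖X = p─q⊆p (V G ─ X) _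

    𝒴⊆V′ : C L.∈ 𝒴 → C ⊆ V G′
    𝒴⊆V′ C∈𝒴 u∈C = x∈p∧x∉q⇒x∈p─q
      (x∈p∧x∉q⇒x∈p─q (p─q⊆p (V G) S (𝒴⊆V∖S C∈𝒴 u∈C)) (λ u∈X → X∩𝒴-empty C∈𝒴 u∈X u∈C))
      (λ u∈Z′ → proj₂ (x∈p─q⁻ Z (X ∪ U) u∈Z′) (x∈p∪q⁺ (inj₂ (x∈⋃⁺ C∈𝒴 u∈C))))

    ∉U⇒∈V∖Z : u ∈ V G′ → u ∉ U → u ∈ V (G ∖ Z)
    ∉U⇒∈V∖Z {u} u∈V′ u∉U with x∈p─q⁻ (V G ─ X) _ u∈V′
    ... | u∈V∖X , u∉Z′ with x∈p─q⁻ (V G) X u∈V∖X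
    ... | u∈V , u∉X = x∈p∧x∉q⇒x∈p─q u∈V (λ u∈Z → u∉Z′ (x∈p∧x∉q⇒x∈p─q u∈Z u∉X∪U))
      where
      u∉X∪U : u ∉ X ∪ U
      u∉X∪U u∈X∪U with x∈p∪q⁻ X U u∈X∪U
      ... | inj₁ u∈X = u∉X u∈X
      ... | inj₂ u∈U = u∉U u∈U

    disjoint-from-U⇒⊆V∖Z : C ⊆ V G′ → ¬ Nonempty (C ∩ U) → C ⊆ V (G ∖ Z)
    disjoint-from-U⇒⊆V∖Z C⊆V′ C∩U-empty u∈C = ∉U⇒∈V∖Z (C⊆V′ u∈C) (λ u∈U → C∩U-empty (_ , x∈p∩q⁺ (u∈C , u∈U)))

    mult≤1-at-𝒴 : C L.∈ 𝒴 → u ∈ C → v ∈ V G′ → mult G u v ≤ 1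
    mult≤1-at-𝒴 {C} {u} {v} C∈𝒴 u∈C v∈V′ with v ∈? C | 1 ≤? mult G u v
    ... | yes v∈C | _       = proj₂ (proj₁ S-deletion) u v (𝒴⊆V∖S C∈𝒴 u∈C) (𝒴⊆V∖S C∈𝒴 v∈C)
    ... | no _    | no  1≰m = <⇒≤ (≰⇒> 1≰m)
    ... | no v∉C  | yes 1≤m = contradiction
      (𝒴-closed C∈𝒴 V′⊆V∖X u v u∈C (𝒴⊆V′ C∈𝒴 u∈C , v∈V′ , (λ { refl → v∉C u∈C }) , 1≤m)) v∉C

    simple′ : Simple G′
    simple′ = no-loops , mult≤1
      where
      no-loops : ∀ u → u ∈ V G′ → mult G u u ≡ 0
      no-loops u u∈V′ with u ∈? U
      ... | yes u∈U = let (C , C∈𝒴 , u∈C) = x∈⋃⁻ 𝒴 u∈U in proj₁ (proj₁ S-deletion) u (𝒴⊆V∖S C∈𝒴 u∈C)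
      ... | no u∉U  = proj₁ (proj₁ Z-deletion) u (∉U⇒∈V∖Z u∈V′ u∉U)
      mult≤1 : ∀ u v → u ∈ V G′ → v ∈ V G′ → mult G u v ≤ 1
      mult≤1 u v u∈V′ v∈V′ with u ∈? U | v ∈? U
      ... | yes u∈U | _       = let (C , C∈𝒴 , u∈C) = x∈⋃⁻ 𝒴 u∈U in mult≤1-at-𝒴 C∈𝒴 u∈C v∈V′
      ... | no _    | yes v∈U = let (C , C∈𝒴 , v∈C) = x∈⋃⁻ 𝒴 v∈U in
        subst (_≤ 1) (mult-sym G v u) (mult≤1-at-𝒴 C∈𝒴 v∈C u∈V′)
      ... | no u∉U  | no v∉U  = proj₂ (proj₁ Z-deletion) u v (∉U⇒∈V∖Z u∈V′ u∉U) (∉U⇒∈V∖Z v∈V′ v∉U)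

    components′ : ∀ C → IsComponent G′ C → IsClique G′ C ⊎ IsTree G′ C
    components′ C ((c , c∈C) , C⊆V′ , C-connected , _) with nonempty? (C ∩ U)
    ... | yes (u , u∈C∩U) =
      let (u∈C , u∈U) = x∈p∩q⁻ C U u∈C∩U
          (D , D∈𝒴 , u∈D) = x∈⋃⁻ 𝒴 u∈U
          C⊆D = connected-⊆-closed {H = G′} C⊆V′ C-connected (𝒴-closed D∈𝒴 V′⊆V∖X) u∈C u∈D
      in inj₁ (clique-transfer G (proj₁ (proj₂ (All.lookup 𝒴-big D∈𝒴))) C⊆D C⊆V′)
    ... | no C∩U-empty with component-exists (disjoint-from-U⇒⊆V∖Z C⊆V′ C∩U-empty c∈C)
    ... | D , D-component@(_ , D⊆V∖Z , _ , D-closed) , c∈D =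
      clique-or-tree-transfer G D⊆V∖Z C⊆D C⊆V′ C-connected (proj₂ Z-deletion D D-component)
      where
      C⊆D : C ⊆ D
      C⊆D = connected-⊆-closed {H = G ∖ Z} (disjoint-from-U⇒⊆V∖Z C⊆V′ C∩U-empty) C-connected D-closed c∈C c∈D

    restricted-deletion-set : CTDeletionSet (G ∖ X) (Z ─ (X ∪ U))
    restricted-deletion-set = simple′ , components′

  disjoint-from-Z⇒⊆V∖Z : ∀ {Z} → C L.∈ 𝒴 → ¬ Nonempty (C ∩ Z) → C ⊆ V (G ∖ Z)
  disjoint-from-Z⇒⊆V∖Z C∈𝒴 C∩Z-empty u∈C =
    x∈p∧x∉q⇒x∈p─q (p─q⊆p (V G) S (𝒴⊆V∖S C∈𝒴 u∈C)) (λ u∈Z → C∩Z-empty (_ , x∈p∩q⁺ (u∈C , u∈Z)))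

  ∣X∣≤∣Z∩[X∪U]∣ : ∀ {Z M} → CTDeletionSet G Z → IsExpansion 2 G S X 𝒴 M → ∣ X ∣ ≤ ∣ Z ∩ (X ∪ U) ∣
  ∣X∣≤∣Z∩[X∪U]∣ {Z} {M} Z-deletion (M-unique , M-edges , degS≡2 , degC≤1) =
    injective-relation⇒∣p∣≤∣q∣ Charged charge charge-injective
    where
    Charged : Fin n → Fin n → Set
    Charged a b = b ≡ a ⊎ ∃ λ C → (a , C) L.∈ M × b ∈ C

    partner∈𝒴 : ∀ {a C} → (a , C) L.∈ M → C L.∈ 𝒴
    partner∈𝒴 e∈M = proj₁ (proj₂ (All.lookup M-edges e∈M))

    charged-in-partner : ∀ {a b C} → (a , C) L.∈ M → b ∈ C ∩ Z → b ∈ Z ∩ (X ∪ U) × Charged a b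
    charged-in-partner e∈M b∈C∩Z with x∈p∩q⁻ _ Z b∈C∩Z
    ... | b∈C , b∈Z = x∈p∩q⁺ (b∈Z , x∈p∪q⁺ (inj₂ (x∈⋃⁺ (partner∈𝒴 e∈M) b∈C))) , inj₂ (_ , e∈M , b∈C)

    charge : ∀ {a} → a ∈ X → ∃ λ b → b ∈ Z ∩ (X ∪ U) × Charged a b
    charge {a} a∈X with a ∈? Z
    ... | yes a∈Z = a , x∈p∩q⁺ (a∈Z , x∈p∪q⁺ (inj₁ a∈X)) , inj₁ refl
    ... | no a∉Z
      with 2≤filter-length⇒distinct (λ e → proj₁ e Fin.≟ a) M-unique (≤-reflexive (sym (degS≡2 a a∈X)))
    ... | (_ , C₁) , (_ , C₂) , e₁∈M , e₂∈M , refl , refl , e₁≢e₂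
      with nonempty? (C₁ ∩ Z) | nonempty? (C₂ ∩ Z)
    ... | yes (b , b∈C₁∩Z) | _                  = b , charged-in-partner e₁∈M b∈C₁∩Z
    ... | no _             | yes (b , b∈C₂∩Z) = b , charged-in-partner e₂∈M b∈C₂∩Z
    ... | no C₁∩Z-empty    | no C₂∩Z-empty    = contradiction (cong (a ,_) C₁≡C₂) e₁≢e₂
      where
      C₁≡C₂ : C₁ ≡ C₂
      C₁≡C₂ = surviving-big-clique-neighbour-unique G Z-deletion
        (x∈p∧x∉q⇒x∈p─q (S⊆V (X⊆S a∈X)) a∉Z)
        (All.lookup 𝒴-big (partner∈𝒴 e₁∈M)) (All.lookup 𝒴-big (partner∈𝒴 e₂∈M))
        (proj₂ (proj₂ (All.lookup M-edges e₁∈M))) (proj₂ (proj₂ (All.lookup M-edges e₂∈M)))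
        (disjoint-from-Z⇒⊆V∖Z (partner∈𝒴 e₁∈M) C₁∩Z-empty) (disjoint-from-Z⇒⊆V∖Z (partner∈𝒴 e₂∈M) C₂∩Z-empty)

    charge-injective : ∀ {a a′ b} → a ∈ X → a′ ∈ X → Charged a b → Charged a′ b → a ≡ a′
    charge-injective _ _ (inj₁ refl) (inj₁ refl) = refl
    charge-injective a∈X _ (inj₁ refl) (inj₂ (_ , e∈M , a∈C)) =
      contradiction a∈C (X∩𝒴-empty (partner∈𝒴 e∈M) a∈X)
    charge-injective _ a′∈X (inj₂ (_ , e∈M , a′∈C)) (inj₁ refl) =
      contradiction a′∈C (X∩𝒴-empty (partner∈𝒴 e∈M) a′∈X)
    charge-injective _ _ (inj₂ (C , e∈M , b∈C)) (inj₂ (C′ , e′∈M , b∈C′))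
      with components-≡ (𝒴-component (partner∈𝒴 e∈M)) (𝒴-component (partner∈𝒴 e′∈M)) b∈C b∈C′
    ... | refl =
      cong proj₁ (filter-length≤1⇒≡ (λ e → proj₂ e ≟S C) (degC≤1 C (partner∈𝒴 e∈M)) e∈M e′∈M refl refl)

  restrict-yes-instance : ∀ {k M} → IsExpansion 2 G S X 𝒴 M →
    YesInstance G k → YesInstance (G ∖ X) (k - + ∣ X ∣)
  restrict-yes-instance M-expansion (Z , Z⊆V , ∣Z∣≤k , Z-deletion) =
    Z ─ (X ∪ U) , Z′⊆V∖X , m+n≤k⇒m≤k-n (ℤ.≤-trans (+≤+ ∣Z′∣+∣X∣≤∣Z∣) ∣Z∣≤k) ,
    restricted-deletion-set Z-deletion
    where
    Z′⊆V∖X : Z ─ (X ∪ U) ⊆ V G ─ X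
    Z′⊆V∖X u∈Z′ with x∈p─q⁻ Z (X ∪ U) u∈Z′
    ... | u∈Z , u∉X∪U = x∈p∧x∉q⇒x∈p─q (Z⊆V u∈Z) (u∉X∪U ∘ x∈p∪q⁺ ∘ inj₁)
    ∣Z′∣+∣X∣≤∣Z∣ : ∣ Z ─ (X ∪ U) ∣ ℕ.+ ∣ X ∣ ≤ ∣ Z ∣
    ∣Z′∣+∣X∣≤∣Z∣ = begin
      ∣ Z ─ (X ∪ U) ∣ ℕ.+ ∣ X ∣              ≤⟨ ℕ.+-monoʳ-≤ _ (∣X∣≤∣Z∩[X∪U]∣ Z-deletion M-expansion) ⟩
      ∣ Z ─ (X ∪ U) ∣ ℕ.+ ∣ Z ∩ (X ∪ U) ∣    ≡⟨ ∣p─q∣+∣p∩q∣≡∣p∣ Z (X ∪ U) ⟩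
      ∣ Z ∣                                  ∎
      where open ℕ.≤-Reasoning

lemma17 : ∀ {n} (G : Multigraph n) (k : ℤ) (S : Subset n) →
    S ⊆ V G → CTDeletionSet G S → (+ ∣ S ∣) ℤ.≤ (+ 4) ℤ.* k →
    -- |𝒞| ≥ 2|S|
    (Σ (List (Subset n)) λ Cs → Unique Cs × All (BigClique G S) Cs × 2 * ∣ S ∣ ≤ length Cs) →
    (X : Subset n) → X ⊆ S → Nonempty X →
    (𝒴 : List (Subset n)) → Unique 𝒴 → All (BigClique G S) 𝒴 → 𝒴 ≢ [] →
    (∃ λ M → IsExpansion 2 G S X 𝒴 M) →
    (∀ s C → C L.∈ 𝒴 → HAdj G S s C → s ∈ X) →
    (YesInstance G k ⇔ YesInstance (G ∖ X) (k - (+ ∣ X ∣)))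
lemma17 G k S S⊆V S-deletion _ _ X X⊆S _ 𝒴 _ 𝒴-big _ (M , M-expansion) N[𝒴]⊆X =
  mk⇔ (restrict-yes-instance M-expansion) (lift-yes-instance G (S⊆V ∘ X⊆S))
  where open Reduction G S X 𝒴 S⊆V S-deletion X⊆S 𝒴-big N[𝒴]⊆X
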